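{- Let $H=([n],\mathcal{I})$ be an interval hypergraph and $G_1$ its conflict graph. For a positive integer $q$, call $S\subseteq V(G_1)$ $q$-admissible if $|S\cap Q|=1$ for every $Q\in\mathcal{Q}_1$ and $|S\cap Q|\le q$ for every $Q\in\mathcal{Q}_2$. Let $q_{min}$ be the smallest $q$ for which a $q$-admissible set exists, let $S_{min}$ be a $q_{min}$-admissible set, and define $t:\mathcal{I}\to[n]$ by $t(I)=u$ if $(I,u)\in S_{min}$. Then $t$ is a representative function obtained from some conflict-free colouring of $H$ (i.e., there is a conflict-free colouring of $H$ under which every $I\in\mathcal{I}$ is CF coloured by $t(I)$), and $\omega(\Gamma_t)\le q_{min}$.
   Context: An interval hypergraph is $H=([n],\mathcal{I})$ with hyperedges intervals $\{i,\dots,j\}\subseteq[n]$. A function $C:[n]\to\{0,\dots,k\}$ is a conflict-free colouring if every $I\in\mathcal{I}$ contains a non-zero colour appearing exactly once in $I$; $I$ is CF coloured by $v\in I$ if $C(v)\ne0$ and $C(u)\ne C(v)$ for all $u\in I\setminus\{v\}$. The conflict graph $G_1$ has nodes $(I,v)$, $I\in\mathcal{I}$, $v\in I$; its edges are $E_{edge}$ = pairs of distinct nodes $(I,v),(I,u)$, and $E_{colour}$ = pairs $(I,v),(J,u)$ with $u\ne v$ and $\{u,v\}\subseteq I$ or $\{u,v\}\subseteq J$. $\mathcal{Q}_1$ is the family of cliques $\{(I,u):u\in I\}$, one for each $I\in\mathcal{I}$ (Type 1 cliques). $\mathcal{Q}_2$ is the family of maximal cliques of $G_1$ that contain at least one edge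 of $E_{colour}$ (Type 2 cliques). For $t:\mathcal{I}\to[n]$ with $t(I)\in I$ and image $R$, the co-occurrence graph $\Gamma_t$ has vertex set $R$, distinct $u,v$ adjacent iff some $I\in\mathcal{I}$ has $u,v\in I$ and $t(I)\in\{u,v\}$. $\omega$ denotes clique number. -}

module Defs where

open import Data.Nat using (ℕ; zero; suc; _<_) renaming (_≤_ to _≤ℕ_)
open import Data.Fin using (Fin; _≤_; _≤?_)
open import Data.Bool using (Bool; true; false; T; _∧_)
open import Data.List using (List; length; filterᵇ; concatMap; map; allFin)
open import Data.Product using (Σ; ∃; _×_; _,_)
open import Data.Sum using (_⊎_)
open import Relation.Binary.PropositionalEquality using (_≡_; _≢_)
open import Relation.Nullary using (¬_)
open import Relation.Nullary.Decidable using (⌊_⌋)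
open import Data.Fin using (_≟_)

-- An interval hypergraph on [n] = Fin n (0-indexed): the hyperedges are the
-- intervals {i,…,j} (i ≤ j) with  𝓘 i j ≡ true.  (Pairs with i > j are ignored.)
IntervalFamily : ℕ → Set
IntervalFamily n = Fin n → Fin n → Bool

HEdge : ∀ {n} → IntervalFamily n → Fin n → Fin n → Set
HEdge 𝓘 i j = T (𝓘 i j) × i ≤ j

_∈[_,_] : ∀ {n} → Fin n → Fin n → Fin n → Set
v ∈[ i , j ] = i ≤ v × v ≤ j

_∈ᵇ[_,_] : ∀ {n} → Fin n → Fin n → Fin n → Bool
v ∈ᵇ[ i , j ] = ⌊ i ≤? v ⌋ ∧ ⌊ v ≤? j ⌋

-- candidate node (I , v) of the conflict graph, with I = [i,j]: the triple (i , j , v)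
Node : ℕ → Set
Node n = Fin n × Fin n × Fin n

ValidNode : ∀ {n} → IntervalFamily n → Node n → Set
ValidNode 𝓘 (i , j , v) = HEdge 𝓘 i j × v ∈[ i , j ]

EdgeE : ∀ {n} → Node n → Node n → Set
EdgeE (i , j , v) (i' , j' , u) = i ≡ i' × j ≡ j' × u ≢ v

ColourE : ∀ {n} → Node n → Node n → Set
ColourE (i , j , v) (i' , j' , u) =
  u ≢ v × ((u ∈[ i , j ] × v ∈[ i , j ]) ⊎ (u ∈[ i' , j' ] × v ∈[ i' , j' ]))

Adj : ∀ {n} → IntervalFamily n → Node n → Node n → Set
Adj 𝓘 x y = ValidNode 𝓘 x × ValidNode 𝓘 y × x ≢ y × (EdgeE x y ⊎ ColourE x y)

-- finite subsets of nodes are Boolean predicates; counting over all triples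
allNodes : (n : ℕ) → List (Node n)
allNodes n = concatMap (λ i → concatMap (λ j → map (λ v → (i , j , v)) (allFin n)) (allFin n)) (allFin n)

count : ∀ {n} → (Node n → Bool) → ℕ
count {n} P = length (filterᵇ P (allNodes n))

∣_∩_∣ : ∀ {n} → (Node n → Bool) → (Node n → Bool) → ℕ
∣ S ∩ Q ∣ = count (λ x → S x ∧ Q x)

IsVertexSubset : ∀ {n} → IntervalFamily n → (Node n → Bool) → Set
IsVertexSubset 𝓘 S = ∀ x → T (S x) → ValidNode 𝓘 x

Q₁ : ∀ {n} → Fin n → Fin n → Node n → Bool
Q₁ i j (i' , j' , u) = ⌊ i ≟ i' ⌋ ∧ ⌊ j ≟ j' ⌋ ∧ u ∈ᵇ[ i , j ]

IsClique : ∀ {n} → IntervalFamily n → (Node n → Bool) → Set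
IsClique 𝓘 Q = IsVertexSubset 𝓘 Q × (∀ x y → T (Q x) → T (Q y) → x ≢ y → Adj 𝓘 x y)

IsMaximalClique : ∀ {n} → IntervalFamily n → (Node n → Bool) → Set
IsMaximalClique 𝓘 Q =
  IsClique 𝓘 Q ×
  (∀ z → ValidNode 𝓘 z → Q z ≡ false → ¬ (∀ x → T (Q x) → Adj 𝓘 x z))

IsType2 : ∀ {n} → IntervalFamily n → (Node n → Bool) → Set
IsType2 𝓘 Q = IsMaximalClique 𝓘 Q × ∃ λ x → ∃ λ y → T (Q x) × T (Q y) × ColourE x y

Admissible : ∀ {n} → IntervalFamily n → ℕ → (Node n → Bool) → Set
Admissible 𝓘 q S =
  IsVertexSubset 𝓘 S ×
  (∀ i j → HEdge 𝓘 i j → ∣ S ∩ Q₁ i j ∣ ≡ 1) ×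
  (∀ Q → IsType2 𝓘 Q → ∣ S ∩ Q ∣ ≤ℕ q)

-- the interval [i,j] is CF coloured by v under the colouring C (colour 0 = uncoloured)
CFColouredBy : ∀ {n} → (Fin n → ℕ) → Fin n → Fin n → Fin n → Set
CFColouredBy C i j v = v ∈[ i , j ] × C v ≢ 0 × (∀ u → u ∈[ i , j ] → u ≢ v → C u ≢ C v)

IsCFColouring : ∀ {n} → IntervalFamily n → (Fin n → ℕ) → Set
IsCFColouring 𝓘 C = ∀ i j → HEdge 𝓘 i j → ∃ λ v → CFColouredBy C i j v

-- co-occurrence graph Γ_t; t is given as t i j = t([i,j])
InImage : ∀ {n} → IntervalFamily n → (Fin n → Fin n → Fin n) → Fin n → Set
InImage 𝓘 t u = ∃ λ i → ∃ λ j → HEdge 𝓘 i j × t i j ≡ u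

ΓAdj : ∀ {n} → IntervalFamily n → (Fin n → Fin n → Fin n) → Fin n → Fin n → Set
ΓAdj 𝓘 t u v = u ≢ v × (∃ λ i → ∃ λ j → HEdge 𝓘 i j × u ∈[ i , j ] × v ∈[ i , j ]
                                        × (t i j ≡ u ⊎ t i j ≡ v))

IsΓClique : ∀ {n} → IntervalFamily n → (Fin n → Fin n → Fin n) → (Fin n → Bool) → Set
IsΓClique 𝓘 t K = (∀ u → T (K u) → InImage 𝓘 t u) ×
                  (∀ u v → T (K u) → T (K v) → u ≢ v → ΓAdj 𝓘 t u v)

sizeV : ∀ {n} → (Fin n → Bool) → ℕ
sizeV {n} K = length (filterᵇ K (allFin n))

CliqueNumberAtMost : ∀ {n} → IntervalFamily n → (Fin n → Fin n → Fin n) → ℕ → Set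
CliqueNumberAtMost 𝓘 t q = ∀ K → IsΓClique 𝓘 t K → sizeV K ≤ℕ q

module Submission where

-- Lemma 3.  Colouring part: giving every point its own non-zero colour makes every
-- point of an interval a conflict-free colour of it, and t I ∈ I because
-- (I , t I) ∈ S ⊆ V(G₁).
--
-- Clique part.  For a
-- clique K of Γ_t we choose, by peeling the first or last point of K off a shrinking
-- window, a hyperedge X u with t (X u) = u for every u ∈ K such that of two distinct
-- u, v ∈ K one of X u, X v contains both.  The nodes (X u , u) are then pairwise
-- joined by colour edges, so they lie in a maximal clique Q of G₁ (built greedily),
-- of Type 2 once |K| ≥ 2.  They belong to S and carry distinct vertices, hence
-- |K| ≤ |S ∩ Q| ≤ q.

open import Defs
open import Data.Nat using (ℕ; zero; suc; _+_; _<_; _≤_; z≤n; s≤s) renaming (_≟_ to _≟ℕ_)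
open import Data.Nat.Properties
  using (≤-trans; ≤∧≢⇒<; ≤⇒≯; m<1+n⇒m≤n; +-suc; +-identityʳ; suc-injective; module ≤-Reasoning)
open import Data.Fin using (Fin; toℕ; _≟_; _≤?_)
open import Data.Fin.Properties using (toℕ-injective; toℕ<n; any?)
open import Data.Bool using (Bool; false; T; _∧_)
open import Data.Bool.Properties using (T?; T-∧)
open import Data.Unit using (⊤; tt)
open import Data.Empty using (⊥-elim)
open import Data.Product using (Σ; ∃; _×_; _,_; proj₁; proj₂)
open import Data.Product.Properties using (≡-dec)
open import Data.Sum using (_⊎_; inj₁; inj₂)
open import Data.List using (List; []; _∷_; length; map; foldl; allFin; filterᵇ)
open import Data.List.Properties using (length-map)
open import Data.List.Membership.Propositional using (_∈_; lose)
open import Data.List.Membership.Propositional.Properties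
  using (∈-map⁺; ∈-map⁻; ∈-filter⁺; ∈-filter⁻; ∈-concatMap⁺; ∈-allFin)
import Data.List.Membership.DecPropositional as DecMembership
open import Data.List.Relation.Unary.Any using (here; there)
open import Data.List.Relation.Unary.All using (All; _∷_; all?; tabulate)
import Data.List.Relation.Unary.All as All
open import Data.List.Relation.Unary.AllPairs using (_∷_)
open import Data.List.Relation.Unary.Unique.Propositional using (Unique)
open import Data.List.Relation.Unary.Unique.Propositional.Properties using (allFin⁺; filter⁺)
open import Function using (_∘_; Equivalence)
open import Relation.Binary.Definitions using (DecidableEquality)
open import Relation.Binary.PropositionalEquality
  using (_≡_; _≢_; refl; sym; cong; subst; ≢-sym)
open import Relation.Nullary using (Dec; yes; no; ¬_)
open import Relation.Nullary.Decidable using (_×-dec_; _⊎-dec_; ¬?; ⌊_⌋; toWitness; fromWitness)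

remove : ∀ {A : Set} {x : A} {ys : List A} → x ∈ ys →
  ∃ λ ys′ → suc (length ys′) ≡ length ys × (∀ {z} → z ∈ ys → z ≢ x → z ∈ ys′)
remove {ys = _ ∷ ys} (here refl) = ys , refl , keep
  where
  keep : ∀ {z} → z ∈ _ ∷ ys → z ≢ _ → z ∈ ys
  keep (here refl) z≢x = ⊥-elim (z≢x refl)
  keep (there z∈ys) _  = z∈ys
remove {ys = y ∷ _} (there x∈ys) with remove x∈ys
... | ys′ , shorter , keep = y ∷ ys′ , cong suc shorter , keep′
  where
  keep′ : ∀ {z} → z ∈ y ∷ _ → z ≢ _ → z ∈ y ∷ ys′
  keep′ (here refl)  _   = here refl
  keep′ (there z∈ys) z≢x = there (keep z∈ys z≢x)

unique-length-≤ : ∀ {A : Set} {xs ys : List A} →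
  Unique xs → (∀ {z} → z ∈ xs → z ∈ ys) → length xs ≤ length ys
unique-length-≤ {xs = []} _ _ = z≤n
unique-length-≤ {xs = x ∷ xs} (x∉xs ∷ xs-unique) xs⊆ys with remove (xs⊆ys (here refl))
... | ys′ , shorter , keep =
  subst (suc (length xs) ≤_) shorter (s≤s (unique-length-≤ xs-unique xs⊆ys′))
  where
  xs⊆ys′ : ∀ {z} → z ∈ xs → z ∈ ys′
  xs⊆ys′ z∈xs = keep (xs⊆ys (there z∈xs)) (≢-sym (All.lookup x∉xs z∈xs))

short-or-distinct-pair : ∀ {A : Set} (xs : List A) → Unique xs →
  length xs ≤ 1 ⊎ (∃ λ u → ∃ λ v → u ∈ xs × v ∈ xs × u ≢ v)
short-or-distinct-pair []            _                = inj₁ z≤n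
short-or-distinct-pair (_ ∷ [])      _                = inj₁ (s≤s z≤n)
short-or-distinct-pair (x ∷ y ∷ _) ((x≢y ∷ _) ∷ _) =
  inj₂ (x , y , here refl , there (here refl) , x≢y)

module GreedyClique {A : Set} (V : A → Set) (V? : ∀ x → Dec (V x))
                    (E : A → A → Set) (E? : ∀ x y → Dec (E x y))
                    (E-sym : ∀ {x y} → E x y → E y x) where

  IsCliqueList : List A → Set
  IsCliqueList L = (∀ {x} → x ∈ L → V x) × (∀ {x y} → x ∈ L → y ∈ L → x ≢ y → E x y)

  adjoin : List A → A → List A
  adjoin acc z with V? z ×-dec all? (λ x → E? x z) acc
  ... | yes _ = z ∷ acc
  ... | no  _ = acc

  adjoin-⊇ : ∀ acc z {x} → x ∈ acc → x ∈ adjoin acc z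
  adjoin-⊇ acc z x∈acc with V? z ×-dec all? (λ x → E? x z) acc
  ... | yes _ = there x∈acc
  ... | no  _ = x∈acc

  adjoin-clique : ∀ acc z → IsCliqueList acc → IsCliqueList (adjoin acc z)
  adjoin-clique acc z (acc-V , acc-E) with V? z ×-dec all? (λ x → E? x z) acc
  ... | no  _ = acc-V , acc-E
  ... | yes (Vz , acc→z) = V′ , E′
    where
    V′ : ∀ {x} → x ∈ z ∷ acc → V x
    V′ (here refl) = Vz
    V′ (there x∈)  = acc-V x∈
    E′ : ∀ {x y} → x ∈ z ∷ acc → y ∈ z ∷ acc → x ≢ y → E x y
    E′ (here refl) (here refl) z≢z = ⊥-elim (z≢z refl)
    E′ (here refl) (there y∈)  _   = E-sym (All.lookup acc→z y∈)
    E′ (there x∈)  (here refl) _   = All.lookup acc→z x∈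
    E′ (there x∈)  (there y∈)  x≢y = acc-E x∈ y∈ x≢y

  adjoin-∋ : ∀ acc z → V z → All (λ x → E x z) acc → z ∈ adjoin acc z
  adjoin-∋ acc z Vz acc→z with V? z ×-dec all? (λ x → E? x z) acc
  ... | yes _     = here refl
  ... | no  ¬adj = ⊥-elim (¬adj (Vz , acc→z))

  greedy : List A → List A → List A
  greedy = foldl adjoin

  greedy-⊇ : ∀ acc zs {x} → x ∈ acc → x ∈ greedy acc zs
  greedy-⊇ acc []       x∈ = x∈
  greedy-⊇ acc (z ∷ zs) x∈ = greedy-⊇ (adjoin acc z) zs (adjoin-⊇ acc z x∈)

  greedy-clique : ∀ acc zs → IsCliqueList acc → IsCliqueList (greedy acc zs)
  greedy-clique acc []       c = c
  greedy-clique acc (z ∷ zs) c = greedy-clique (adjoin acc z) zs (adjoin-clique acc z c)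

  greedy-maximal : ∀ acc zs z → z ∈ zs → V z →
    (∀ x → x ∈ greedy acc zs → E x z) → z ∈ greedy acc zs
  greedy-maximal acc (y ∷ zs) z (there z∈zs) Vz all→z =
    greedy-maximal (adjoin acc y) zs z z∈zs Vz all→z
  greedy-maximal acc (z ∷ zs) z (here refl) Vz all→z =
    greedy-⊇ (adjoin acc z) zs (adjoin-∋ acc z Vz (tabulate acc→z))
    where
    acc→z : ∀ {x} → x ∈ acc → E x z
    acc→z x∈ = all→z _ (greedy-⊇ (adjoin acc z) zs (adjoin-⊇ acc z x∈))

_≟ᴺ_ : ∀ {n} → DecidableEquality (Node n)
_≟ᴺ_ = ≡-dec _≟_ (≡-dec _≟_ _≟_)

allNodes-complete : ∀ {n} (x : Node n) → x ∈ allNodes n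
allNodes-complete (i , j , v) =
  ∈-concatMap⁺ _ (lose (∈-allFin i) (∈-concatMap⁺ _ (lose (∈-allFin j) (∈-map⁺ _ (∈-allFin v)))))

vertexOf : ∀ {n} → Node n → Fin n
vertexOf (_ , _ , v) = v

count-≥ : ∀ {n} (P : Node n → Bool) {us : List (Fin n)} → Unique us →
  (∀ {u} → u ∈ us → ∃ λ x → T (P x) × vertexOf x ≡ u) → length us ≤ count P
count-≥ {n} P {us} us-unique witnessed = begin
  length us                                      ≤⟨ unique-length-≤ us-unique carried ⟩
  length (map vertexOf (filterᵇ P (allNodes n))) ≡⟨ length-map vertexOf (filterᵇ P (allNodes n)) ⟩
  count P                                        ∎
  where
  open ≤-Reasoning
  carried : ∀ {u} → u ∈ us → u ∈ map vertexOf (filterᵇ P (allNodes n))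
  carried u∈us with witnessed u∈us
  ... | x , Px , refl = ∈-map⁺ vertexOf (∈-filter⁺ (T? ∘ P) (allNodes-complete x) Px)

module ConflictGraph {n} (𝓘 : IntervalFamily n) where

  _∈[_,_]? : ∀ (v i j : Fin n) → Dec (v ∈[ i , j ])
  v ∈[ i , j ]? = (i ≤? v) ×-dec (v ≤? j)

  validNode? : ∀ x → Dec (ValidNode 𝓘 x)
  validNode? (i , j , v) = ((T? (𝓘 i j)) ×-dec (i ≤? j)) ×-dec (v ∈[ i , j ]?)

  adj? : ∀ x y → Dec (Adj 𝓘 x y)
  adj? x@(i , j , v) y@(i′ , j′ , u) =
    validNode? x ×-dec (validNode? y ×-dec (¬? (x ≟ᴺ y) ×-dec (edge? ⊎-dec colour?)))
    where
    edge?   = (i ≟ i′) ×-dec ((j ≟ j′) ×-dec ¬? (u ≟ v))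
    colour? = ¬? (u ≟ v) ×-dec (((u ∈[ i , j ]?) ×-dec (v ∈[ i , j ]?))
                        ⊎-dec ((u ∈[ i′ , j′ ]?) ×-dec (v ∈[ i′ , j′ ]?)))

  adj-sym : ∀ {x y} → Adj 𝓘 x y → Adj 𝓘 y x
  adj-sym (Vx , Vy , x≢y , inj₁ (i≡ , j≡ , u≢v)) =
    Vy , Vx , ≢-sym x≢y , inj₁ (sym i≡ , sym j≡ , ≢-sym u≢v)
  adj-sym (Vx , Vy , x≢y , inj₂ (u≢v , inj₁ inI)) =
    Vy , Vx , ≢-sym x≢y , inj₂ (≢-sym u≢v , inj₂ (proj₂ inI , proj₁ inI))
  adj-sym (Vx , Vy , x≢y , inj₂ (u≢v , inj₂ inJ)) =
    Vy , Vx , ≢-sym x≢y , inj₂ (≢-sym u≢v , inj₁ (proj₂ inJ , proj₁ inJ))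

  open GreedyClique (ValidNode 𝓘) validNode? (Adj 𝓘) adj? adj-sym public
    using (IsCliqueList; greedy; greedy-⊇; greedy-clique; greedy-maximal)
  open DecMembership (_≟ᴺ_ {n}) using (_∈?_)

  maximal-clique-through : ∀ L → IsCliqueList L →
    ∃ λ Q → IsMaximalClique 𝓘 Q × (∀ {x} → x ∈ L → T (Q x))
  maximal-clique-through L L-clique = Q , (is-clique , is-maximal) , L⊆Q
    where
    F : List (Node n)
    F = greedy L (allNodes n)
    F-clique : IsCliqueList F
    F-clique = greedy-clique L (allNodes n) L-clique
    Q : Node n → Bool
    Q x = ⌊ x ∈? F ⌋
    is-clique : IsClique 𝓘 Q
    is-clique = (λ x Qx → proj₁ F-clique (toWitness Qx))
              , (λ x y Qx Qy x≢y → proj₂ F-clique (toWitness Qx) (toWitness Qy) x≢y)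
    is-maximal : ∀ z → ValidNode 𝓘 z → Q z ≡ false → ¬ (∀ x → T (Q x) → Adj 𝓘 x z)
    is-maximal z Vz Qz≡false all→z = subst T Qz≡false (fromWitness z∈F)
      where
      z∈F : z ∈ F
      z∈F = greedy-maximal L (allNodes n) z (allNodes-complete z) Vz
              (λ x x∈F → all→z x (fromWitness x∈F))
    L⊆Q : ∀ {x} → x ∈ L → T (Q x)
    L⊆Q x∈L = fromWitness (greedy-⊇ L (allNodes n) x∈L)

InWindow : ∀ {n} → ℕ → ℕ → Fin n → Set
InWindow lo d u = lo ≤ toℕ u × toℕ u < lo + d

window-empty : ∀ {n} lo {u : Fin n} → ¬ InWindow lo 0 u
window-empty lo (lo≤u , u<lo) = ≤⇒≯ lo≤u (subst (_ <_) (+-identityʳ lo) u<lo)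

window-everything : ∀ {n} (u : Fin n) → InWindow 0 n u
window-everything u = z≤n , toℕ<n u

window-last : ∀ {n lo d} {u : Fin n} → InWindow lo (suc d) u → toℕ u ≤ lo + d
window-last {lo = lo} {d} {u} (_ , u<) = m<1+n⇒m≤n (subst (toℕ u <_) (+-suc lo d) u<)

window-drop-first : ∀ {n lo d} {u : Fin n} → toℕ u ≢ lo → InWindow lo (suc d) u → InWindow (suc lo) d u
window-drop-first {lo = lo} {d} {u} u≢lo (lo≤u , u<) =
  ≤∧≢⇒< lo≤u (≢-sym u≢lo) , subst (toℕ u <_) (+-suc lo d) u<

window-drop-last : ∀ {n lo d} {u : Fin n} → toℕ u ≢ lo + d → InWindow lo (suc d) u → InWindow lo d u
window-drop-last u≢last w = proj₁ w , ≤∧≢⇒< (window-last w) u≢last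

window-convex : ∀ {n lo d} {a b v i j : Fin n} → toℕ a ≡ lo → toℕ b ≡ lo + d →
  a ∈[ i , j ] → b ∈[ i , j ] → InWindow lo (suc d) v → v ∈[ i , j ]
window-convex {v = v} a≡first b≡last (i≤a , _) (_ , b≤j) w =
  ≤-trans i≤a (subst (_≤ toℕ v) (sym a≡first) (proj₁ w)) ,
  ≤-trans (subst (toℕ v ≤_) (sym b≡last) (window-last w)) b≤j

other-position : ∀ {n} {u a : Fin n} {k} → toℕ a ≡ k → u ≢ a → toℕ u ≢ k
other-position refl u≢a u≡a = u≢a (toℕ-injective u≡a)

module Representation {n} (𝓘 : IntervalFamily n) (t : Fin n → Fin n → Fin n)
  (t-in : ∀ i j → HEdge 𝓘 i j → t i j ∈[ i , j ])
  (K : Fin n → Bool) (K-clique : IsΓClique 𝓘 t K) where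

  Realises : Fin n × Fin n → Fin n → Set
  Realises I u = HEdge 𝓘 (proj₁ I) (proj₂ I) × t (proj₁ I) (proj₂ I) ≡ u

  Covers : Fin n × Fin n → Fin n → Fin n → Set
  Covers I u v = u ∈[ proj₁ I , proj₂ I ] × v ∈[ proj₁ I , proj₂ I ]

  record Represents (X : Fin n → Fin n × Fin n) (P : Fin n → Set) : Set where
    field
      realises : ∀ u → T (K u) → P u → Realises (X u) u
      covers   : ∀ u v → T (K u) → T (K v) → P u → P v → u ≢ v →
                 Covers (X u) u v ⊎ Covers (X v) u v

  Representable : (Fin n → Set) → Set
  Representable P = Σ (Fin n → Fin n × Fin n) λ X → Represents X P

  representable-mono : ∀ {P P′} → (∀ u → T (K u) → P u → P′ u) →
    Representable P′ → Representable P
  representable-mono P⊆P′ (X , R) = X , record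
    { realises = λ u Ku Pu → realises u Ku (P⊆P′ u Ku Pu)
    ; covers   = λ u v Ku Kv Pu Pv → covers u v Ku Kv (P⊆P′ u Ku Pu) (P⊆P′ v Kv Pv) }
    where open Represents R

  representable-extend : ∀ {P P′} e i j → HEdge 𝓘 i j → t i j ≡ e →
    (∀ v → T (K v) → P v → v ∈[ i , j ]) →
    (∀ u → T (K u) → P u → u ≢ e → P′ u) →
    Representable P′ → Representable P
  representable-extend {P} e i j hij t≡e inside rest (X , R) =
    X′ , record { realises = realises′ ; covers = covers′ }
    where
    open Represents R
    X′ : Fin n → Fin n × Fin n
    X′ u with u ≟ e
    ... | yes _ = i , j
    ... | no  _ = X u
    e-in : e ∈[ i , j ]
    e-in = subst (_∈[ i , j ]) t≡e (t-in i j hij)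
    realises′ : ∀ u → T (K u) → P u → Realises (X′ u) u
    realises′ u Ku Pu with u ≟ e
    ... | yes refl = hij , t≡e
    ... | no  u≢e = realises u Ku (rest u Ku Pu u≢e)
    covers′ : ∀ u v → T (K u) → T (K v) → P u → P v → u ≢ v →
              Covers (X′ u) u v ⊎ Covers (X′ v) u v
    covers′ u v Ku Kv Pu Pv u≢v with u ≟ e | v ≟ e
    ... | yes refl | _        = inj₁ (e-in , inside v Kv Pv)
    ... | no  _    | yes refl = inj₂ (inside u Ku Pu , e-in)
    ... | no  u≢e  | no  v≢e  =
      covers u v Ku Kv (rest u Ku Pu u≢e) (rest v Kv Pv v≢e) u≢v

  common-hyperedge : ∀ a b → T (K a) → T (K b) → ∃ λ i → ∃ λ j →
    HEdge 𝓘 i j × a ∈[ i , j ] × b ∈[ i , j ] × (t i j ≡ a ⊎ t i j ≡ b)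
  common-hyperedge a b Ka Kb with a ≟ b
  ... | no  a≢b  = proj₂ (proj₂ K-clique a b Ka Kb a≢b)
  ... | yes refl with proj₁ K-clique a Ka
  ...   | i , j , hij , t≡a = i , j , hij , a-in , a-in , inj₁ t≡a
    where
    a-in : a ∈[ i , j ]
    a-in = subst (_∈[ i , j ]) t≡a (t-in i j hij)

  PointAt : ℕ → Set
  PointAt k = ∃ λ u → T (K u) × toℕ u ≡ k

  pointAt? : ∀ k → Dec (PointAt k)
  pointAt? k = any? (λ u → T? (K u) ×-dec (toℕ u ≟ℕ k))

  -- induction on the window length: drop an end of the window carrying no point of
  -- K, or else choose the common hyperedge of the two end points for its representative
  represent-window : ∀ d lo → Representable (InWindow lo d)
  represent-window zero lo = (λ u → u , u) , record
    { realises = λ _ _ w → ⊥-elim (window-empty lo w)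
    ; covers   = λ _ _ _ _ w _ _ → ⊥-elim (window-empty lo w) }
  represent-window (suc d) lo with pointAt? lo | pointAt? (lo + d)
  ... | no ¬first | _ = representable-mono
        (λ u Ku → window-drop-first (λ u≡lo → ¬first (u , Ku , u≡lo)))
        (represent-window d (suc lo))
  ... | yes _ | no ¬last = representable-mono
        (λ u Ku → window-drop-last (λ u≡last → ¬last (u , Ku , u≡last)))
        (represent-window d lo)
  ... | yes (a , Ka , a≡first) | yes (b , Kb , b≡last) with common-hyperedge a b Ka Kb
  ...   | i , j , hij , a-in , b-in , inj₁ t≡a = representable-extend a i j hij t≡a
          (λ v _ → window-convex a≡first b≡last a-in b-in)
          (λ u _ w u≢a → window-drop-first (other-position a≡first u≢a) w)
          (represent-window d (suc lo))
  ...   | i , j , hij , a-in , b-in , inj₂ t≡b = representable-extend b i j hij t≡b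
          (λ v _ → window-convex a≡first b≡last a-in b-in)
          (λ u _ w u≢b → window-drop-last (other-position b≡last u≢b) w)
          (represent-window d lo)

  represent-all : Representable (λ _ → ⊤)
  represent-all = representable-mono (λ u _ _ → window-everything u) (represent-window n 0)

module CliqueBound {n} (𝓘 : IntervalFamily n) (t : Fin n → Fin n → Fin n)
  (t-in : ∀ i j → HEdge 𝓘 i j → t i j ∈[ i , j ])
  (K : Fin n → Bool) (K-clique : IsΓClique 𝓘 t K) where

  open Representation 𝓘 t t-in K K-clique
  open ConflictGraph 𝓘

  X : Fin n → Fin n × Fin n
  X = proj₁ represent-all

  open Represents (proj₂ represent-all)

  members : List (Fin n)
  members = filterᵇ K (allFin n)

  members-unique : Unique members
  members-unique = filter⁺ (T? ∘ K) (allFin⁺ n)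

  member-in-K : ∀ {u} → u ∈ members → T (K u)
  member-in-K u∈ = proj₂ (∈-filter⁻ (T? ∘ K) {xs = allFin n} u∈)

  node : Fin n → Node n
  node u = proj₁ (X u) , proj₂ (X u) , u

  node-valid : ∀ u → T (K u) → ValidNode 𝓘 (node u)
  node-valid u Ku with realises u Ku tt
  ... | hX , t≡u = hX , subst (_∈[ proj₁ (X u) , proj₂ (X u) ]) t≡u (t-in _ _ hX)

  node-colour : ∀ u v → T (K u) → T (K v) → u ≢ v → ColourE (node u) (node v)
  node-colour u v Ku Kv u≢v with covers u v Ku Kv tt tt u≢v
  ... | inj₁ (u-in , v-in) = ≢-sym u≢v , inj₁ (v-in , u-in)
  ... | inj₂ (u-in , v-in) = ≢-sym u≢v , inj₂ (v-in , u-in)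

  nodes-clique : IsCliqueList (map node members)
  nodes-clique = valid , adjacent
    where
    valid : ∀ {x} → x ∈ map node members → ValidNode 𝓘 x
    valid x∈ with ∈-map⁻ node x∈
    ... | u , u∈ , refl = node-valid u (member-in-K u∈)
    adjacent : ∀ {x y} → x ∈ map node members → y ∈ map node members → x ≢ y → Adj 𝓘 x y
    adjacent x∈ y∈ x≢y with ∈-map⁻ node x∈ | ∈-map⁻ node y∈
    ... | u , u∈ , refl | v , v∈ , refl =
      node-valid u (member-in-K u∈) , node-valid v (member-in-K v∈) , x≢y ,
      inj₂ (node-colour u v (member-in-K u∈) (member-in-K v∈) (λ { refl → x≢y refl }))

  -- either |K| ≤ 1 ≤ q, or the chosen nodes lie in S and in a Type 2 clique Q
  size-bound : ∀ q (S : Node n → Bool) → 1 ≤ q → (∀ Q → IsType2 𝓘 Q → ∣ S ∩ Q ∣ ≤ q) →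
    (∀ i j → HEdge 𝓘 i j → T (S (i , j , t i j))) → sizeV K ≤ q
  size-bound q S 1≤q type2-bound t∈S with short-or-distinct-pair members members-unique
  ... | inj₁ ≤1 = ≤-trans ≤1 1≤q
  ... | inj₂ (u , v , u∈ , v∈ , u≢v) with maximal-clique-through (map node members) nodes-clique
  ...   | Q , Q-maximal , nodes⊆Q = ≤-trans (count-≥ _ members-unique in-S∩Q) (type2-bound Q type2)
    where
    in-Q : ∀ {w} → w ∈ members → T (Q (node w))
    in-Q w∈ = nodes⊆Q (∈-map⁺ node w∈)
    in-S∩Q : ∀ {w} → w ∈ members → ∃ λ x → T (S x ∧ Q x) × vertexOf x ≡ w
    in-S∩Q {w} w∈ with realises w (member-in-K w∈) tt
    ... | hX , t≡w = node w , Equivalence.from T-∧ (S-node , in-Q w∈) , refl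
      where
      S-node : T (S (node w))
      S-node = subst (λ r → T (S (proj₁ (X w) , proj₂ (X w) , r))) t≡w (t∈S _ _ hX)
    type2 : IsType2 𝓘 Q
    type2 = Q-maximal , node u , node v , in-Q u∈ , in-Q v∈ ,
            node-colour u v (member-in-K u∈) (member-in-K v∈) u≢v

representative-in-edge : ∀ {n} {𝓘 : IntervalFamily n} {q S} → Admissible 𝓘 q S →
  (t : Fin n → Fin n → Fin n) → (∀ i j → HEdge 𝓘 i j → T (S (i , j , t i j))) →
  ∀ i j → HEdge 𝓘 i j → t i j ∈[ i , j ]
representative-in-edge (S⊆V , _) t t∈S i j hij = proj₂ (S⊆V (i , j , t i j) (t∈S i j hij))

clique-number-bound : ∀ {n} (𝓘 : IntervalFamily n) q (S : Node n → Bool) →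
  1 ≤ q → Admissible 𝓘 q S → (t : Fin n → Fin n → Fin n) →
  (∀ i j → HEdge 𝓘 i j → T (S (i , j , t i j))) → CliqueNumberAtMost 𝓘 t q
clique-number-bound 𝓘 q S 1≤q adm t t∈S K K-clique =
  CliqueBound.size-bound 𝓘 t (representative-in-edge adm t t∈S) K K-clique
    q S 1≤q (proj₂ (proj₂ adm)) t∈S

distinctColours : ∀ {n} → Fin n → ℕ
distinctColours u = suc (toℕ u)

distinctColours-CF : ∀ {n} (i j v : Fin n) → v ∈[ i , j ] → CFColouredBy distinctColours i j v
distinctColours-CF i j v v-in =
  v-in , (λ ()) , λ u _ u≢v same → u≢v (toℕ-injective (suc-injective same))

lemma3 : ∀ {n} (𝓘 : IntervalFamily n) (qmin : ℕ) (Smin : Node n → Bool) →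
    1 ≤ qmin →
    (∀ q S → 1 ≤ q → q < qmin → ¬ Admissible 𝓘 q S) →
    Admissible 𝓘 qmin Smin →
    (t : Fin n → Fin n → Fin n) →
    (∀ i j → HEdge 𝓘 i j → T (Smin (i , j , t i j))) →
    (∃ λ C → IsCFColouring 𝓘 C × (∀ i j → HEdge 𝓘 i j → CFColouredBy C i j (t i j)))
    × CliqueNumberAtMost 𝓘 t qmin
lemma3 𝓘 qmin Smin 1≤qmin _ adm t t∈S =
  (distinctColours , (λ i j hij → t i j , cf i j hij) , cf) ,
  clique-number-bound 𝓘 qmin Smin 1≤qmin adm t t∈S
  where
  cf : ∀ i j → HEdge 𝓘 i j → CFColouredBy distinctColours i j (t i j)
  cf i j hij = distinctColours-CF i j (t i j) (representative-in-edge adm t t∈S i j hij)
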